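{- Let $\eta>0$. There are constants $c_\eta$ and $M_\eta$ depending only on $\eta$ such that the following holds. Let $M\ge M_\eta$, $C>0$, and let $F$ be a real-valued function on $\{1,\ldots,M\}$ such that $\|\Delta_kF\|_1\le C$ for all integers $1\le k\le\eta M$. Then $\|F-\mathbb{E}F\|_1\le c_\eta C$.
   Context: For an integer $k\ge1$, $\Delta_kF(m)=F(m+k)-F(m)$, defined for $1\le m\le M-k$. $\|G\|_1$ is the sum of $|G(m)|$ over the domain of $G$. $\mathbb{E}F=\frac1M\sum_{m=1}^MF(m)$.
   Formalization: The parameters η and C and the values of F are rational instead of real, and the constant $c_\eta$ is taken in the rationals. -}

module Defs where

open import Data.Nat using (ℕ; zero; suc; _∸_; NonZero)
import Data.Nat as ℕ
open import Data.Integer using (+_)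
open import Data.Rational using (ℚ; 0ℚ; _+_; _-_; _*_; _/_; ∣_∣)

ℕ→ℚ : ℕ → ℚ
ℕ→ℚ n = + n / 1

Σ₁ : ℕ → (ℕ → ℚ) → ℚ
Σ₁ zero    f = 0ℚ
Σ₁ (suc n) f = Σ₁ n f + f (suc n)

Δ : ℕ → (ℕ → ℚ) → ℕ → ℚ
Δ k F m = F (m ℕ.+ k) - F m

-- ‖Δ_k F‖₁ = Σ_{m=1}^{M-k} |Δ_k F (m)|   (empty sum if k ≥ M)
‖Δ‖₁ : (M k : ℕ) → (ℕ → ℚ) → ℚ
‖Δ‖₁ M k F = Σ₁ (M ∸ k) (λ m → ∣ Δ k F m ∣)

𝔼 : (M : ℕ) → .{{_ : NonZero M}} → (ℕ → ℚ) → ℚ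
𝔼 M F = Σ₁ M F * (+ 1 / M)

‖F-𝔼F‖₁ : (M : ℕ) → .{{_ : NonZero M}} → (ℕ → ℚ) → ℚ
‖F-𝔼F‖₁ M F = Σ₁ M (λ m → ∣ F m - 𝔼 M F ∣)

-- The map k ↦ ‖Δ_k F‖₁ is subadditive, because Δ_{a+b}F(m) = Δ_aF(m+b) + Δ_bF(m); hence the
-- bound C on the shifts k ≤ ηM becomes a bound N·C on all shifts k ≤ M, with N = 2q for η = p/q.
-- Indexing {1,…,M} cyclically, M(𝔼F − F m) = Σ_k (F(m ⊕ k) − F m), and the k-th cyclic difference
-- has ℓ¹ norm ‖Δ_k F‖₁ + ‖Δ_{M−k} F‖₁. Averaging over k gives ‖F − 𝔼F‖₁ ≤ 2·max_k ‖Δ_k F‖₁ ≤ 2N·C.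
module Submission where

open import Data.Nat using (ℕ; zero; suc; _∸_; z≤n; s≤s; NonZero)
import Data.Nat as ℕ
import Data.Nat.Properties as ℕ
import Data.Nat.DivMod as DivMod
import Data.Nat.Coprimality as Coprimality
import Data.Integer as ℤ
import Data.Integer.Properties as ℤ
open import Data.Rational
  using (ℚ; 0ℚ; 1ℚ; _+_; _-_; _*_; _/_; 1/_; ∣_∣; _≤_; _<_; mkℚ; *<*; ↧ₙ_; toℚᵘ; NonNegative)
import Data.Rational.Properties as ℚ
import Data.Rational.Unnormalised as ℚᵘ
import Data.Rational.Unnormalised.Properties as ℚᵘ
open import Data.Rational.Solver using (module +-*-Solver)
open +-*-Solver using (solve; _:=_; _:+_; _:-_; _:*_; :-_)
open import Data.Product using (Σ; _,_)
open import Function using (_∘_)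
open import Relation.Binary.PropositionalEquality
open import Relation.Nullary using (yes; no; contradiction)

open import Defs

private
  variable
    m n : ℕ
    f g : ℕ → ℚ

ℕ→ℚ≡mkℚ : ∀ n → ℕ→ℚ n ≡ mkℚ (ℤ.+ n) 0 (Coprimality.sym (Coprimality.1-coprimeTo n))
ℕ→ℚ≡mkℚ n = ℚ.normalize-coprime _

ℕ→ℚ-suc : ∀ n → ℕ→ℚ (suc n) ≡ ℕ→ℚ n + 1ℚ
ℕ→ℚ-suc n = begin
  ℤ.+ suc n / 1                               ≡⟨ cong (λ i → ℤ.+ i / 1) (ℕ.+-comm 1 n) ⟩
  (ℤ.+ n ℤ.+ ℤ.+ 1) / 1                       ≡⟨ cong (λ i → (i ℤ.+ ℤ.+ 1) / 1) (sym (ℤ.*-identityʳ (ℤ.+ n))) ⟩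
  (ℤ.+ n ℤ.* ℤ.+ 1 ℤ.+ ℤ.+ 1 ℤ.* ℤ.+ 1) / 1   ≡⟨ cong (_+ 1ℚ) (sym (ℕ→ℚ≡mkℚ n)) ⟩
  ℕ→ℚ n + 1ℚ                                  ∎
  where open ≡-Reasoning

ℕ→ℚ*[1/n]≡1 : ∀ n .{{_ : NonZero n}} → ℕ→ℚ n * (ℤ.+ 1 / n) ≡ 1ℚ
ℕ→ℚ*[1/n]≡1 (suc n) = begin
  ℕ→ℚ (suc n) * (ℤ.+ 1 / suc n)
    ≡⟨ cong₂ _*_ (ℕ→ℚ≡mkℚ (suc n)) (ℚ.normalize-coprime (Coprimality.1-coprimeTo (suc n))) ⟩
  p * 1/ p
    ≡⟨ ℚ.*-inverseʳ p ⟩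
  1ℚ
    ∎
  where
  open ≡-Reasoning
  p = mkℚ (ℤ.+ suc n) 0 (Coprimality.sym (Coprimality.1-coprimeTo (suc n)))

-- A positive η = p/q satisfies η ≥ 1/q.
k*↧η≤M⇒k≤η*M : ∀ η → 0ℚ < η → ∀ k M → k ℕ.* ↧ₙ η ℕ.≤ M → ℕ→ℚ k ≤ η * ℕ→ℚ M
k*↧η≤M⇒k≤η*M (mkℚ ℤ.+0 _ _)       (*<* (ℤ.+<+ ()))
k*↧η≤M⇒k≤η*M (mkℚ ℤ.-[1+ _ ] _ _) (*<* ())
k*↧η≤M⇒k≤η*M η@(mkℚ ℤ.+[1+ p ] d _) _ k M k[1+d]≤M =
  ℚ.toℚᵘ-cancel-≤ (ℚᵘ.≤-respʳ-≃ (ℚᵘ.≃-sym (ℚ.toℚᵘ-homo-* η (ℕ→ℚ M))) unnormalised)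
  where
  unnormalised : toℚᵘ (ℕ→ℚ k) ℚᵘ.≤ toℚᵘ η ℚᵘ.* toℚᵘ (ℕ→ℚ M)
  unnormalised rewrite ℕ→ℚ≡mkℚ k | ℕ→ℚ≡mkℚ M = ℚᵘ.*≤* (begin
    ℤ.+ k ℤ.* ℤ.+ (suc d ℕ.* 1)      ≡⟨ cong (λ n → ℤ.+ k ℤ.* ℤ.+ n) (ℕ.*-identityʳ (suc d)) ⟩
    ℤ.+ k ℤ.* ℤ.+ suc d              ≡⟨ sym (ℤ.pos-* k (suc d)) ⟩
    ℤ.+ (k ℕ.* suc d)                ≤⟨ ℤ.+≤+ (ℕ.≤-trans k[1+d]≤M (ℕ.m≤n*m M (suc p))) ⟩
    ℤ.+ (suc p ℕ.* M)                ≡⟨ ℤ.pos-* (suc p) M ⟩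
    ℤ.+[1+ p ] ℤ.* ℤ.+ M             ≡⟨ sym (ℤ.*-identityʳ _) ⟩
    ℤ.+[1+ p ] ℤ.* ℤ.+ M ℤ.* ℤ.+ 1   ∎)
    where open ℤ.≤-Reasoning

m≤[n+n]*[m/n] : ∀ {m n} .{{_ : NonZero n}} → n ℕ.≤ m → m ℕ.≤ (n ℕ.+ n) ℕ.* (m ℕ./ n)
m≤[n+n]*[m/n] {m} {n} n≤m = begin
  m                                ≡⟨ DivMod.m≡m%n+[m/n]*n m n ⟩
  m ℕ.% n ℕ.+ m ℕ./ n ℕ.* n         ≤⟨ ℕ.+-monoˡ-≤ _ (DivMod.m%n≤n m n) ⟩
  n ℕ.+ m ℕ./ n ℕ.* n               ≤⟨ ℕ.+-monoˡ-≤ _ (ℕ.m≤n*m n (m ℕ./ n)) ⟩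
  m ℕ./ n ℕ.* n ℕ.+ m ℕ./ n ℕ.* n   ≡⟨ sym (ℕ.*-distribˡ-+ (m ℕ./ n) n n) ⟩
  m ℕ./ n ℕ.* (n ℕ.+ n)             ≡⟨ ℕ.*-comm (m ℕ./ n) (n ℕ.+ n) ⟩
  (n ℕ.+ n) ℕ.* (m ℕ./ n)           ∎
  where
  open ℕ.≤-Reasoning
  instance
    m/n≢0 : NonZero (m ℕ./ n)
    m/n≢0 = ℕ.>-nonZero (DivMod.m≥n⇒m/n>0 n≤m)

p≤p+q : ∀ {p q} → 0ℚ ≤ q → p ≤ p + q
p≤p+q {p} {q} 0≤q = subst (_≤ p + q) (ℚ.+-identityʳ p) (ℚ.+-monoʳ-≤ p 0≤q)

p≤q+p : ∀ {p q} → 0ℚ ≤ q → p ≤ q + p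
p≤q+p {p} {q} 0≤q = subst (_≤ q + p) (ℚ.+-identityˡ p) (ℚ.+-monoˡ-≤ p 0≤q)

∣p-q∣≡∣q-p∣ : ∀ p q → ∣ p - q ∣ ≡ ∣ q - p ∣
∣p-q∣≡∣q-p∣ p q = trans (cong ∣_∣ (solve 2 (λ p q → p :- q := :- (q :- p)) refl p q)) (ℚ.∣-p∣≡∣p∣ (q - p))

Σ₁-cong : ∀ n → (∀ m → 1 ℕ.≤ m → m ℕ.≤ n → f m ≡ g m) → Σ₁ n f ≡ Σ₁ n g
Σ₁-cong zero    f≡g = refl
Σ₁-cong (suc n) f≡g = cong₂ _+_
  (Σ₁-cong n (λ m 1≤m m≤n → f≡g m 1≤m (ℕ.m≤n⇒m≤1+n m≤n)))
  (f≡g (suc n) (s≤s z≤n) ℕ.≤-refl)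

Σ₁-mono : ∀ n → (∀ m → 1 ℕ.≤ m → m ℕ.≤ n → f m ≤ g m) → Σ₁ n f ≤ Σ₁ n g
Σ₁-mono zero    f≤g = ℚ.≤-refl
Σ₁-mono (suc n) f≤g = ℚ.+-mono-≤
  (Σ₁-mono n (λ m 1≤m m≤n → f≤g m 1≤m (ℕ.m≤n⇒m≤1+n m≤n)))
  (f≤g (suc n) (s≤s z≤n) ℕ.≤-refl)

Σ₁-nonNeg : ∀ n → (∀ m → 0ℚ ≤ f m) → 0ℚ ≤ Σ₁ n f
Σ₁-nonNeg zero    0≤f = ℚ.≤-refl
Σ₁-nonNeg (suc n) 0≤f = ℚ.+-mono-≤ (Σ₁-nonNeg n 0≤f) (0≤f (suc n))

Σ₁-const : ∀ n x → Σ₁ n (λ _ → x) ≡ ℕ→ℚ n * x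
Σ₁-const zero    x = sym (ℚ.*-zeroˡ x)
Σ₁-const (suc n) x = begin
  Σ₁ n (λ _ → x) + x      ≡⟨ cong (_+ x) (Σ₁-const n x) ⟩
  ℕ→ℚ n * x + x           ≡⟨ cong ((ℕ→ℚ n * x) +_) (sym (ℚ.*-identityˡ x)) ⟩
  ℕ→ℚ n * x + 1ℚ * x      ≡⟨ sym (ℚ.*-distribʳ-+ x (ℕ→ℚ n) 1ℚ) ⟩
  (ℕ→ℚ n + 1ℚ) * x        ≡⟨ cong (_* x) (sym (ℕ→ℚ-suc n)) ⟩
  ℕ→ℚ (suc n) * x         ∎
  where open ≡-Reasoning

Σ₁-distrib-+ : ∀ n (f g : ℕ → ℚ) → Σ₁ n (λ m → f m + g m) ≡ Σ₁ n f + Σ₁ n g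
Σ₁-distrib-+ zero    f g = refl
Σ₁-distrib-+ (suc n) f g = trans (cong (_+ (f (suc n) + g (suc n))) (Σ₁-distrib-+ n f g))
  (solve 4 (λ a b c d → (a :+ b) :+ (c :+ d) := (a :+ c) :+ (b :+ d)) refl
    (Σ₁ n f) (Σ₁ n g) (f (suc n)) (g (suc n)))

Σ₁-distrib-sub : ∀ n (f g : ℕ → ℚ) → Σ₁ n (λ m → f m - g m) ≡ Σ₁ n f - Σ₁ n g
Σ₁-distrib-sub zero    f g = refl
Σ₁-distrib-sub (suc n) f g = trans (cong (_+ (f (suc n) - g (suc n))) (Σ₁-distrib-sub n f g))
  (solve 4 (λ a b c d → (a :- b) :+ (c :- d) := (a :+ c) :- (b :+ d)) refl
    (Σ₁ n f) (Σ₁ n g) (f (suc n)) (g (suc n)))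

Σ₁-*ʳ : ∀ n (f : ℕ → ℚ) c → Σ₁ n (λ m → f m * c) ≡ Σ₁ n f * c
Σ₁-*ʳ zero    f c = sym (ℚ.*-zeroˡ c)
Σ₁-*ʳ (suc n) f c = trans (cong (_+ f (suc n) * c) (Σ₁-*ʳ n f c))
  (sym (ℚ.*-distribʳ-+ c (Σ₁ n f) (f (suc n))))

∣Σ₁∣≤Σ₁∣∣ : ∀ n (f : ℕ → ℚ) → ∣ Σ₁ n f ∣ ≤ Σ₁ n (λ m → ∣ f m ∣)
∣Σ₁∣≤Σ₁∣∣ zero    f = ℚ.≤-refl
∣Σ₁∣≤Σ₁∣∣ (suc n) f = ℚ.≤-trans (ℚ.∣p+q∣≤∣p∣+∣q∣ (Σ₁ n f) (f (suc n)))
  (ℚ.+-monoˡ-≤ ∣ f (suc n) ∣ (∣Σ₁∣≤Σ₁∣∣ n f))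

Σ₁-split : ∀ a b (f : ℕ → ℚ) → Σ₁ (a ℕ.+ b) f ≡ Σ₁ a f + Σ₁ b (λ m → f (m ℕ.+ a))
Σ₁-split a zero    f = trans (cong (λ n → Σ₁ n f) (ℕ.+-identityʳ a)) (sym (ℚ.+-identityʳ (Σ₁ a f)))
Σ₁-split a (suc b) f = begin
  Σ₁ (a ℕ.+ suc b) f
    ≡⟨ cong (λ n → Σ₁ n f) (ℕ.+-suc a b) ⟩
  Σ₁ (a ℕ.+ b) f + f (suc (a ℕ.+ b))
    ≡⟨ cong₂ _+_ (Σ₁-split a b f) (cong (f ∘ suc) (ℕ.+-comm a b)) ⟩
  (Σ₁ a f + Σ₁ b (λ m → f (m ℕ.+ a))) + f (suc b ℕ.+ a)
    ≡⟨ ℚ.+-assoc (Σ₁ a f) _ _ ⟩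
  Σ₁ a f + Σ₁ (suc b) (λ m → f (m ℕ.+ a))
    ∎
  where open ≡-Reasoning

Σ₁-swap : ∀ a b (g : ℕ → ℕ → ℚ) →
          Σ₁ a (λ i → Σ₁ b (g i)) ≡ Σ₁ b (λ j → Σ₁ a (λ i → g i j))
Σ₁-swap zero    b g = sym (trans (Σ₁-const b 0ℚ) (ℚ.*-zeroʳ (ℕ→ℚ b)))
Σ₁-swap (suc a) b g = trans (cong (_+ Σ₁ b (g (suc a))) (Σ₁-swap a b g))
  (sym (Σ₁-distrib-+ b (λ j → Σ₁ a (λ i → g i j)) (g (suc a))))

Σ₁-mono-≤-length : (∀ m → 0ℚ ≤ f m) → m ℕ.≤ n → Σ₁ m f ≤ Σ₁ n f
Σ₁-mono-≤-length {f} {m} {n} 0≤f m≤n = begin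
  Σ₁ m f                                     ≤⟨ p≤p+q (Σ₁-nonNeg (n ∸ m) (λ i → 0≤f (i ℕ.+ m))) ⟩
  Σ₁ m f + Σ₁ (n ∸ m) (λ i → f (i ℕ.+ m))    ≡⟨ sym (Σ₁-split m (n ∸ m) f) ⟩
  Σ₁ (m ℕ.+ (n ∸ m)) f                       ≡⟨ cong (λ k → Σ₁ k f) (ℕ.m+[n∸m]≡n m≤n) ⟩
  Σ₁ n f                                     ∎
  where open ℚ.≤-Reasoning

Σ₁-tail-≤ : ∀ n b → (∀ m → 0ℚ ≤ f m) → Σ₁ (n ∸ b) (λ m → f (m ℕ.+ b)) ≤ Σ₁ n f
Σ₁-tail-≤ {f} n b 0≤f with b ℕ.≤? n
... | yes b≤n = begin
  Σ₁ (n ∸ b) (λ m → f (m ℕ.+ b))             ≤⟨ p≤q+p (Σ₁-nonNeg b 0≤f) ⟩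
  Σ₁ b f + Σ₁ (n ∸ b) (λ m → f (m ℕ.+ b))    ≡⟨ sym (Σ₁-split b (n ∸ b) f) ⟩
  Σ₁ (b ℕ.+ (n ∸ b)) f                       ≡⟨ cong (λ k → Σ₁ k f) (ℕ.m+[n∸m]≡n b≤n) ⟩
  Σ₁ n f                                     ∎
  where open ℚ.≤-Reasoning
... | no b≰n rewrite ℕ.m≤n⇒m∸n≡0 (ℕ.<⇒≤ (ℕ.≰⇒> b≰n)) = Σ₁-nonNeg n 0≤f

Subadditive : (ℕ → ℚ) → Set
Subadditive φ = ∀ a b → φ (a ℕ.+ b) ≤ φ a + φ b

subadditive-bound-on-multiples : ∀ {φ K C} → Subadditive φ → φ 0 ≤ 0ℚ → (∀ e → e ℕ.≤ K → φ e ≤ C) →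
                                 ∀ j e → e ℕ.≤ j ℕ.* K → φ e ≤ ℕ→ℚ j * C
subadditive-bound-on-multiples {C = C} sub φ0≤0 φ≤C zero e e≤0 rewrite ℕ.n≤0⇒n≡0 e≤0 =
  ℚ.≤-trans φ0≤0 (ℚ.≤-reflexive (sym (ℚ.*-zeroˡ C)))
subadditive-bound-on-multiples {φ} {K} {C} sub φ0≤0 φ≤C (suc j) e e≤[1+j]K = begin
  φ e                          ≡⟨ cong φ (trans (sym (ℕ.m⊓n+n∸m≡n K e)) (ℕ.+-comm (K ℕ.⊓ e) (e ∸ K))) ⟩
  φ ((e ∸ K) ℕ.+ K ℕ.⊓ e)      ≤⟨ sub (e ∸ K) (K ℕ.⊓ e) ⟩
  φ (e ∸ K) + φ (K ℕ.⊓ e)      ≤⟨ ℚ.+-mono-≤ (subadditive-bound-on-multiples sub φ0≤0 φ≤C j (e ∸ K) e∸K≤jK)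
                                              (φ≤C (K ℕ.⊓ e) (ℕ.m⊓n≤m K e)) ⟩
  ℕ→ℚ j * C + C                ≡⟨ cong (_+ C) (sym (Σ₁-const j C)) ⟩
  Σ₁ (suc j) (λ _ → C)         ≡⟨ Σ₁-const (suc j) C ⟩
  ℕ→ℚ (suc j) * C              ∎
  where
  open ℚ.≤-Reasoning
  e∸K≤jK : e ∸ K ℕ.≤ j ℕ.* K
  e∸K≤jK = subst (e ∸ K ℕ.≤_) (ℕ.m+n∸m≡n K (j ℕ.* K)) (ℕ.∸-monoˡ-≤ K e≤[1+j]K)

Δ-+ : ∀ a b (F : ℕ → ℚ) m → Δ (a ℕ.+ b) F m ≡ Δ a F (m ℕ.+ b) + Δ b F m
Δ-+ a b F m = begin
  F (m ℕ.+ (a ℕ.+ b)) - F m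
    ≡⟨ cong (λ i → F i - F m) m+[a+b]≡[m+b]+a ⟩
  F (m ℕ.+ b ℕ.+ a) - F m
    ≡⟨ solve 3 (λ x y z → x :- z := (x :- y) :+ (y :- z)) refl (F (m ℕ.+ b ℕ.+ a)) (F (m ℕ.+ b)) (F m) ⟩
  (F (m ℕ.+ b ℕ.+ a) - F (m ℕ.+ b)) + (F (m ℕ.+ b) - F m)
    ∎
  where
  open ≡-Reasoning
  m+[a+b]≡[m+b]+a : m ℕ.+ (a ℕ.+ b) ≡ m ℕ.+ b ℕ.+ a
  m+[a+b]≡[m+b]+a = trans (cong (m ℕ.+_) (ℕ.+-comm a b)) (sym (ℕ.+-assoc m b a))

‖Δ₀‖₁≡0 : ∀ M F → ‖Δ‖₁ M 0 F ≡ 0ℚ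
‖Δ₀‖₁≡0 M F = begin
  Σ₁ M (λ m → ∣ F (m ℕ.+ 0) - F m ∣)   ≡⟨ Σ₁-cong M (λ m _ _ → cong (λ i → ∣ F i - F m ∣) (ℕ.+-identityʳ m)) ⟩
  Σ₁ M (λ m → ∣ F m - F m ∣)           ≡⟨ Σ₁-cong M (λ m _ _ → cong ∣_∣ (ℚ.+-inverseʳ (F m))) ⟩
  Σ₁ M (λ _ → 0ℚ)                      ≡⟨ Σ₁-const M 0ℚ ⟩
  ℕ→ℚ M * 0ℚ                           ≡⟨ ℚ.*-zeroʳ (ℕ→ℚ M) ⟩
  0ℚ                                   ∎
  where open ≡-Reasoning

‖Δ‖₁-subadditive : ∀ M F → Subadditive (λ k → ‖Δ‖₁ M k F)
‖Δ‖₁-subadditive M F a b = begin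
  Σ₁ L (λ m → ∣ Δ (a ℕ.+ b) F m ∣)                                  ≤⟨ Σ₁-mono L (λ m _ _ → Δ-triangle m) ⟩
  Σ₁ L (λ m → ∣ Δ a F (m ℕ.+ b) ∣ + ∣ Δ b F m ∣)                      ≡⟨ Σ₁-distrib-+ L _ _ ⟩
  Σ₁ L (λ m → ∣ Δ a F (m ℕ.+ b) ∣) + Σ₁ L (λ m → ∣ Δ b F m ∣)         ≤⟨ ℚ.+-mono-≤ shifted-a unshifted-b ⟩
  ‖Δ‖₁ M a F + ‖Δ‖₁ M b F                                           ∎
  where
  open ℚ.≤-Reasoning
  L = M ∸ (a ℕ.+ b)
  Δ-triangle : ∀ m → ∣ Δ (a ℕ.+ b) F m ∣ ≤ ∣ Δ a F (m ℕ.+ b) ∣ + ∣ Δ b F m ∣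
  Δ-triangle m = subst (λ x → ∣ x ∣ ≤ ∣ Δ a F (m ℕ.+ b) ∣ + ∣ Δ b F m ∣) (sym (Δ-+ a b F m))
    (ℚ.∣p+q∣≤∣p∣+∣q∣ (Δ a F (m ℕ.+ b)) (Δ b F m))
  shifted-a : Σ₁ L (λ m → ∣ Δ a F (m ℕ.+ b) ∣) ≤ ‖Δ‖₁ M a F
  shifted-a = subst (λ n → Σ₁ n (λ m → ∣ Δ a F (m ℕ.+ b) ∣) ≤ ‖Δ‖₁ M a F) (ℕ.∸-+-assoc M a b)
    (Σ₁-tail-≤ (M ∸ a) b (λ m → ℚ.0≤∣p∣ (Δ a F m)))
  unshifted-b : Σ₁ L (λ m → ∣ Δ b F m ∣) ≤ ‖Δ‖₁ M b F
  unshifted-b = Σ₁-mono-≤-length (λ m → ℚ.0≤∣p∣ (Δ b F m)) (ℕ.∸-monoʳ-≤ M (ℕ.m≤n+m b a))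

-- The representative in {1, …, M} of an index s ∈ {1, …, 2M} taken modulo M.
wrap : ℕ → ℕ → ℕ
wrap M s with s ℕ.≤? M
... | yes _ = s
... | no  _ = s ∸ M

wrap-≤ : ∀ {M s} → s ℕ.≤ M → wrap M s ≡ s
wrap-≤ {M} {s} s≤M with s ℕ.≤? M
... | yes _   = refl
... | no  s≰M = contradiction s≤M s≰M

wrap-+ : ∀ {M i} → 1 ℕ.≤ i → wrap M (i ℕ.+ M) ≡ i
wrap-+ {M} {i} 1≤i with i ℕ.+ M ℕ.≤? M
... | yes i+M≤M = contradiction i+M≤M (ℕ.<⇒≱ (ℕ.m<n+m M 1≤i))
... | no  _     = ℕ.m+n∸n≡m i M

Σ₁-wrap-split : ∀ M x (G : ℕ → ℕ → ℚ) → x ℕ.≤ M →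
  Σ₁ M (λ j → G j (wrap M (j ℕ.+ x))) ≡ Σ₁ (M ∸ x) (λ j → G j (j ℕ.+ x)) + Σ₁ x (λ i → G (i ℕ.+ (M ∸ x)) i)
Σ₁-wrap-split M x G x≤M = begin
  Σ₁ M (λ j → G j (wrap M (j ℕ.+ x)))
    ≡⟨ cong (λ n → Σ₁ n (λ j → G j (wrap M (j ℕ.+ x)))) (sym (ℕ.m∸n+n≡m x≤M)) ⟩
  Σ₁ (M ∸ x ℕ.+ x) (λ j → G j (wrap M (j ℕ.+ x)))
    ≡⟨ Σ₁-split (M ∸ x) x _ ⟩
  Σ₁ (M ∸ x) (λ j → G j (wrap M (j ℕ.+ x))) + Σ₁ x (λ i → G (i ℕ.+ (M ∸ x)) (wrap M (i ℕ.+ (M ∸ x) ℕ.+ x)))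
    ≡⟨ cong₂ _+_ (Σ₁-cong (M ∸ x) (λ j _ j≤M∸x → cong (G j) (wrap-≤ (j+x≤M j≤M∸x))))
                 (Σ₁-cong x (λ i 1≤i _ → cong (G (i ℕ.+ (M ∸ x))) (wrap-tail 1≤i))) ⟩
  Σ₁ (M ∸ x) (λ j → G j (j ℕ.+ x)) + Σ₁ x (λ i → G (i ℕ.+ (M ∸ x)) i)
    ∎
  where
  open ≡-Reasoning
  j+x≤M : ∀ {j} → j ℕ.≤ M ∸ x → j ℕ.+ x ℕ.≤ M
  j+x≤M j≤M∸x = subst (_ ℕ.≤_) (ℕ.m∸n+n≡m x≤M) (ℕ.+-monoˡ-≤ x j≤M∸x)
  wrap-tail : ∀ {i} → 1 ℕ.≤ i → wrap M (i ℕ.+ (M ∸ x) ℕ.+ x) ≡ i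
  wrap-tail {i} 1≤i = trans (cong (wrap M) (trans (ℕ.+-assoc i (M ∸ x) x) (cong (i ℕ.+_) (ℕ.m∸n+n≡m x≤M))))
                            (wrap-+ 1≤i)

Σ₁-wrap : ∀ M x (f : ℕ → ℚ) → x ℕ.≤ M → Σ₁ M (λ j → f (wrap M (x ℕ.+ j))) ≡ Σ₁ M f
Σ₁-wrap M x f x≤M = begin
  Σ₁ M (λ j → f (wrap M (x ℕ.+ j)))                  ≡⟨ Σ₁-cong M (λ j _ _ → cong (f ∘ wrap M) (ℕ.+-comm x j)) ⟩
  Σ₁ M (λ j → f (wrap M (j ℕ.+ x)))                  ≡⟨ Σ₁-wrap-split M x (λ _ → f) x≤M ⟩
  Σ₁ (M ∸ x) (λ j → f (j ℕ.+ x)) + Σ₁ x f            ≡⟨ ℚ.+-comm _ (Σ₁ x f) ⟩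
  Σ₁ x f + Σ₁ (M ∸ x) (λ j → f (j ℕ.+ x))            ≡⟨ sym (Σ₁-split x (M ∸ x) f) ⟩
  Σ₁ (x ℕ.+ (M ∸ x)) f                               ≡⟨ cong (λ n → Σ₁ n f) (ℕ.m+[n∸m]≡n x≤M) ⟩
  Σ₁ M f                                             ∎
  where open ≡-Reasoning

‖Δ-cyclic‖₁ : (M k : ℕ) → (ℕ → ℚ) → ℚ
‖Δ-cyclic‖₁ M k F = Σ₁ M (λ m → ∣ F (wrap M (m ℕ.+ k)) - F m ∣)

‖Δ-cyclic‖₁≡‖Δ‖₁+‖Δ‖₁ : ∀ M k F → k ℕ.≤ M → ‖Δ-cyclic‖₁ M k F ≡ ‖Δ‖₁ M k F + ‖Δ‖₁ M (M ∸ k) F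
‖Δ-cyclic‖₁≡‖Δ‖₁+‖Δ‖₁ M k F k≤M = begin
  ‖Δ-cyclic‖₁ M k F
    ≡⟨ Σ₁-wrap-split M k (λ m v → ∣ F v - F m ∣) k≤M ⟩
  ‖Δ‖₁ M k F + Σ₁ k (λ i → ∣ F i - F (i ℕ.+ (M ∸ k)) ∣)
    ≡⟨ cong (‖Δ‖₁ M k F +_) (Σ₁-cong k (λ i _ _ → ∣p-q∣≡∣q-p∣ (F i) (F (i ℕ.+ (M ∸ k))))) ⟩
  ‖Δ‖₁ M k F + Σ₁ k (λ i → ∣ Δ (M ∸ k) F i ∣)
    ≡⟨ cong (λ n → ‖Δ‖₁ M k F + Σ₁ n (λ i → ∣ Δ (M ∸ k) F i ∣)) (sym (ℕ.m∸[m∸n]≡n k≤M)) ⟩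
  ‖Δ‖₁ M k F + ‖Δ‖₁ M (M ∸ k) F
    ∎
  where open ≡-Reasoning

𝔼F-F≡mean-cyclic-difference : ∀ M .{{_ : NonZero M}} F m → m ℕ.≤ M →
  𝔼 M F - F m ≡ Σ₁ M (λ k → F (wrap M (m ℕ.+ k)) - F m) * (ℤ.+ 1 / M)
𝔼F-F≡mean-cyclic-difference M F m m≤M = sym (begin
  Σ₁ M (λ k → F (wrap M (m ℕ.+ k)) - F m) * r
    ≡⟨ cong (_* r) (Σ₁-distrib-sub M (λ k → F (wrap M (m ℕ.+ k))) (λ _ → F m)) ⟩
  (Σ₁ M (λ k → F (wrap M (m ℕ.+ k))) - Σ₁ M (λ _ → F m)) * r
    ≡⟨ cong₂ (λ x y → (x - y) * r) (Σ₁-wrap M m F m≤M) (Σ₁-const M (F m)) ⟩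
  (Σ₁ M F - ℕ→ℚ M * F m) * r
    ≡⟨ solve 4 (λ s n f r → (s :- n :* f) :* r := s :* r :- f :* (n :* r)) refl (Σ₁ M F) (ℕ→ℚ M) (F m) r ⟩
  𝔼 M F - F m * (ℕ→ℚ M * r)
    ≡⟨ cong (λ x → 𝔼 M F - F m * x) (ℕ→ℚ*[1/n]≡1 M) ⟩
  𝔼 M F - F m * 1ℚ
    ≡⟨ cong (λ x → 𝔼 M F - x) (ℚ.*-identityʳ (F m)) ⟩
  𝔼 M F - F m
    ∎)
  where
  open ≡-Reasoning
  r = ℤ.+ 1 / M

‖F-𝔼F‖₁≤sup‖Δ-cyclic‖₁ : ∀ M .{{_ : NonZero M}} F B →
                         (∀ k → k ℕ.≤ M → ‖Δ-cyclic‖₁ M k F ≤ B) → ‖F-𝔼F‖₁ M F ≤ B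
‖F-𝔼F‖₁≤sup‖Δ-cyclic‖₁ M F B cyclic≤B = begin
  Σ₁ M (λ m → ∣ F m - 𝔼 M F ∣)
    ≡⟨ Σ₁-cong M (λ m _ m≤M → deviation m m≤M) ⟩
  Σ₁ M (λ m → ∣ A m ∣ * r)
    ≡⟨ Σ₁-*ʳ M (λ m → ∣ A m ∣) r ⟩
  Σ₁ M (λ m → ∣ A m ∣) * r
    ≤⟨ ℚ.*-monoʳ-≤-nonNeg r (Σ₁-mono M (λ m _ _ → ∣Σ₁∣≤Σ₁∣∣ M (λ k → F (wrap M (m ℕ.+ k)) - F m))) ⟩
  Σ₁ M (λ m → Σ₁ M (λ k → ∣ F (wrap M (m ℕ.+ k)) - F m ∣)) * r
    ≡⟨ cong (_* r) (Σ₁-swap M M (λ m k → ∣ F (wrap M (m ℕ.+ k)) - F m ∣)) ⟩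
  Σ₁ M (λ k → ‖Δ-cyclic‖₁ M k F) * r
    ≤⟨ ℚ.*-monoʳ-≤-nonNeg r (Σ₁-mono M (λ k _ k≤M → cyclic≤B k k≤M)) ⟩
  Σ₁ M (λ _ → B) * r
    ≡⟨ cong (_* r) (Σ₁-const M B) ⟩
  ℕ→ℚ M * B * r
    ≡⟨ solve 3 (λ n b r → n :* b :* r := b :* (n :* r)) refl (ℕ→ℚ M) B r ⟩
  B * (ℕ→ℚ M * r)
    ≡⟨ cong (B *_) (ℕ→ℚ*[1/n]≡1 M) ⟩
  B * 1ℚ
    ≡⟨ ℚ.*-identityʳ B ⟩
  B ∎
  where
  open ℚ.≤-Reasoning
  r = ℤ.+ 1 / M
  instance
    r-nonNeg : NonNegative r
    r-nonNeg = ℚ.normalize-nonNeg 1 M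
  A : ℕ → ℚ
  A m = Σ₁ M (λ k → F (wrap M (m ℕ.+ k)) - F m)
  deviation : ∀ m → m ℕ.≤ M → ∣ F m - 𝔼 M F ∣ ≡ ∣ A m ∣ * r
  deviation m m≤M = begin-equality
    ∣ F m - 𝔼 M F ∣   ≡⟨ ∣p-q∣≡∣q-p∣ (F m) (𝔼 M F) ⟩
    ∣ 𝔼 M F - F m ∣   ≡⟨ cong ∣_∣ (𝔼F-F≡mean-cyclic-difference M F m m≤M) ⟩
    ∣ A m * r ∣       ≡⟨ ℚ.∣p*q∣≡∣p∣*∣q∣ (A m) r ⟩
    ∣ A m ∣ * ∣ r ∣   ≡⟨ cong (∣ A m ∣ *_) (ℚ.0≤p⇒∣p∣≡p (ℚ.nonNegative⁻¹ r)) ⟩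
    ∣ A m ∣ * r       ∎

lemma6p5 : (η : ℚ) → 0ℚ < η →
    Σ ℚ λ c → Σ ℕ λ M₀ →
      (M : ℕ) → {{_ : NonZero M}} → M₀ ℕ.≤ M →
      (C : ℚ) → 0ℚ < C → (F : ℕ → ℚ) →
      ((k : ℕ) → 1 ℕ.≤ k → ℕ→ℚ k ≤ η * ℕ→ℚ M → ‖Δ‖₁ M k F ≤ C) →
      ‖F-𝔼F‖₁ M F ≤ c * C
lemma6p5 η@record{} 0<η = ℕ→ℚ N + ℕ→ℚ N , q , bound
  where
  q = ↧ₙ η
  N = q ℕ.+ q
  bound : (M : ℕ) → {{_ : NonZero M}} → q ℕ.≤ M →
          (C : ℚ) → 0ℚ < C → (F : ℕ → ℚ) →
          ((k : ℕ) → 1 ℕ.≤ k → ℕ→ℚ k ≤ η * ℕ→ℚ M → ‖Δ‖₁ M k F ≤ C) →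
          ‖F-𝔼F‖₁ M F ≤ (ℕ→ℚ N + ℕ→ℚ N) * C
  bound M q≤M C 0<C F Δ≤C = begin
    ‖F-𝔼F‖₁ M F                   ≤⟨ ‖F-𝔼F‖₁≤sup‖Δ-cyclic‖₁ M F _ cyclic≤2NC ⟩
    ℕ→ℚ N * C + ℕ→ℚ N * C         ≡⟨ sym (ℚ.*-distribʳ-+ C (ℕ→ℚ N) (ℕ→ℚ N)) ⟩
    (ℕ→ℚ N + ℕ→ℚ N) * C           ∎
    where
    open ℚ.≤-Reasoning
    -- K ≤ ηM, and N = 2q blocks of length K cover every shift k ≤ M.
    K = M ℕ./ q
    Δ≤C-up-to-K : ∀ k → k ℕ.≤ K → ‖Δ‖₁ M k F ≤ C
    Δ≤C-up-to-K zero    _   = ℚ.≤-trans (ℚ.≤-reflexive (‖Δ₀‖₁≡0 M F)) (ℚ.<⇒≤ 0<C)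
    Δ≤C-up-to-K (suc k) k≤K = Δ≤C (suc k) (s≤s z≤n)
      (k*↧η≤M⇒k≤η*M η 0<η (suc k) M (ℕ.≤-trans (ℕ.*-monoˡ-≤ q k≤K) (DivMod.m/n*n≤m M q)))
    Δ≤NC : ∀ k → k ℕ.≤ M → ‖Δ‖₁ M k F ≤ ℕ→ℚ N * C
    Δ≤NC k k≤M = subadditive-bound-on-multiples (‖Δ‖₁-subadditive M F) (ℚ.≤-reflexive (‖Δ₀‖₁≡0 M F))
      Δ≤C-up-to-K N k (ℕ.≤-trans k≤M (m≤[n+n]*[m/n] q≤M))
    cyclic≤2NC : ∀ k → k ℕ.≤ M → ‖Δ-cyclic‖₁ M k F ≤ ℕ→ℚ N * C + ℕ→ℚ N * C
    cyclic≤2NC k k≤M = begin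
      ‖Δ-cyclic‖₁ M k F                  ≡⟨ ‖Δ-cyclic‖₁≡‖Δ‖₁+‖Δ‖₁ M k F k≤M ⟩
      ‖Δ‖₁ M k F + ‖Δ‖₁ M (M ∸ k) F      ≤⟨ ℚ.+-mono-≤ (Δ≤NC k k≤M) (Δ≤NC (M ∸ k) (ℕ.m∸n≤m M k)) ⟩
      ℕ→ℚ N * C + ℕ→ℚ N * C              ∎
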